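{- Let $G=(V,E,C)$ be a $C$-colored graph with no edge $\{u,v\}$ with $c(u)=c(v)$, let $k$ be a positive integer, let $D'$ be the rooted spanning tree of (the connected graph) $G$ produced by a depth-first search, and let $V_A$ be the set of vertices of $D'$ that are the parent of at least one leaf of $D'$. For $v\in V_A$ and a color $c_x\in C$ let $C_x(v)$ be the set of leaves of $D'$ colored $c_x$ and adjacent to $v$ in $D'$. If for some $v\in V_A$ there are at least $\sqrt{2k}$ distinct colors $c_x$ with $C_x(v)\ne\emptyset$, then MEC on $G$ has a solution whose transitive closure has at least $k$ edges.
   Context: A $C$-colored graph assigns to each vertex $v$ a color $c(v)\in C$. A connected component is colorful if no two of its vertices share a color. If a graph has connected components with $n_1,\dots,n_t$ vertices, the number of edges in its transitive closure is $\sum_i n_i(n_i-1)/2$. MEC: given $G=(V,E,C)$, a solution is a set $E'\subseteq E$ such that every connected component of $(V,E\setminus E',C)$ is colorful; its value is the number of edges in the transitive closure of $(V,E\setminus E')$. The paper assumes throughout that no edge joins two vertices of the same color. -}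

module Defs where

open import Data.Nat using (ℕ; zero; suc)
open import Data.Bool using (Bool; true; false; _∧_; _∨_; not)
open import Data.Fin using (Fin; _≟_; _<?_)
open import Data.List using (List; allFin; filterᵇ; length; cartesianProduct)
open import Data.Bool.ListAction using (any)
open import Data.Product using (_×_; _,_; proj₁; proj₂; ∃)
open import Data.Sum using (_⊎_)
open import Relation.Nullary using (¬_; does)
open import Relation.Binary.PropositionalEquality using (_≡_; _≢_)

Adj : ℕ → Set
Adj n = Fin n → Fin n → Bool

SymmetricAdj : ∀ {n} → Adj n → Set
SymmetricAdj E = ∀ u v → E u v ≡ E v u

Loopless : ∀ {n} → Adj n → Set
Loopless E = ∀ u → E u u ≡ false

NoMonochromaticEdge : ∀ {n m} → Adj n → (Fin n → Fin m) → Set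
NoMonochromaticEdge E c = ∀ u v → E u v ≡ true → c u ≢ c v

remove : ∀ {n} → Adj n → Adj n → Adj n
remove E E' u v = E u v ∧ not (E' u v)

reachWithin : ∀ {n} → Adj n → ℕ → Fin n → Fin n → Bool
reachWithin A zero u v = does (u ≟ v)
reachWithin {n} A (suc j) u v =
  reachWithin A j u v ∨ any (λ w → reachWithin A j u w ∧ A w v) (allFin n)

-- u and v lie in the same connected component (walks of length ≤ n suffice).
connectedB : ∀ {n} → Adj n → Fin n → Fin n → Bool
connectedB {n} A u v = reachWithin A n u v

Connected : ∀ {n} → Adj n → Fin n → Fin n → Set
Connected A u v = connectedB A u v ≡ true

AllComponentsColorful : ∀ {n m} → Adj n → (Fin n → Fin m) → Set
AllComponentsColorful A c = ∀ u v → u ≢ v → Connected A u v → c u ≢ c v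

IsMECSolution : ∀ {n m} → Adj n → (Fin n → Fin m) → Adj n → Set
IsMECSolution E c E' =
  (∀ u v → E' u v ≡ true → E u v ≡ true) ×
  SymmetricAdj E' ×
  AllComponentsColorful (remove E E') c

-- Number of edges of the transitive closure: unordered pairs {u,v}, u ≠ v,
-- in the same connected component (= Σ n_i(n_i-1)/2).
transitiveClosureEdges : ∀ {n} → Adj n → ℕ
transitiveClosureEdges {n} A =
  length (filterᵇ (λ p → does (proj₁ p <? proj₂ p) ∧ connectedB A (proj₁ p) (proj₂ p))
                  (cartesianProduct (allFin n) (allFin n)))

mecValue : ∀ {n} → Adj n → Adj n → ℕ
mecValue E E' = transitiveClosureEdges (remove E E')

iter : ∀ {A : Set} → (A → A) → ℕ → A → A
iter f zero x = x
iter f (suc j) x = f (iter f j x)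

Ancestor : ∀ {n} → (Fin n → Fin n) → Fin n → Fin n → Set
Ancestor parent a d = ∃ λ j → iter parent j d ≡ a

IsRootedSpanningTree : ∀ {n} → Adj n → Fin n → (Fin n → Fin n) → Set
IsRootedSpanningTree E root parent =
  parent root ≡ root ×
  (∀ v → v ≢ root → E v (parent v) ≡ true) ×
  (∀ v → Ancestor parent root v)

-- A depth-first-search tree: rooted spanning tree in which every edge of G
-- joins an ancestor/descendant pair (Trémaux / normal spanning tree).
IsDFSTree : ∀ {n} → Adj n → Fin n → (Fin n → Fin n) → Set
IsDFSTree E root parent =
  IsRootedSpanningTree E root parent ×
  (∀ u v → E u v ≡ true → Ancestor parent u v ⊎ Ancestor parent v u)

TreeAdj : ∀ {n} → Fin n → (Fin n → Fin n) → Fin n → Fin n → Set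
TreeAdj root parent a b =
  (a ≢ root × parent a ≡ b) ⊎ (b ≢ root × parent b ≡ a)

IsLeaf : ∀ {n} → Fin n → (Fin n → Fin n) → Fin n → Set
IsLeaf root parent ℓ = ∀ w → w ≢ root → parent w ≢ ℓ

InVA : ∀ {n} → Fin n → (Fin n → Fin n) → Fin n → Set
InVA root parent v =
  ∃ λ ℓ → IsLeaf root parent ℓ × ℓ ≢ root × parent ℓ ≡ v

InCx : ∀ {n m} → Fin n → (Fin n → Fin n) → (Fin n → Fin m) →
       Fin n → Fin m → Fin n → Set
InCx root parent c v x ℓ =
  IsLeaf root parent ℓ × TreeAdj root parent v ℓ × c ℓ ≡ x

-- Delete every edge of G except those joining v to one chosen leaf ℓᵢ of each of the r
-- colours. The ℓᵢ have distinct colours, all different from c(v) since each ℓᵢ is adjacent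
-- to v, so the star on v, ℓ₀, …, ℓᵣ₋₁ is a colorful component and every other component is
-- a single vertex. The star alone contributes (r+1 choose 2) ≥ r²/2 ≥ k edges to the
-- transitive closure.
module Submission where

open import Defs
open import Data.Nat using (ℕ; _*_; _≤_)
open import Data.Fin using (Fin)
open import Data.Product using (_×_; ∃)
open import Relation.Binary.PropositionalEquality using (_≡_)
open import Function.Definitions using (Injective)

open import Data.Nat using (zero; suc; _+_; z≤n; s≤s; _≤′_; ≤′-refl; ≤′-step)
open import Data.Nat.Properties
  using (*-cancelˡ-≤; *-monoˡ-≤; *-distribˡ-+; n≤1+n; ≤-trans; ≤⇒≤′; module ≤-Reasoning)
open import Data.Nat.Combinatorics using (_C_; nC1≡n; nCk+nC[k+1]≡[n+1]C[k+1])
open import Data.Nat.Tactic.RingSolver using (solve)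
open import Data.Fin as Fin using (_<_; _<?_; _≟_)
open import Data.Fin.Properties using (injective⇒≤; <-cmp; any?)
open import Data.Bool using (Bool; true; false; T; _∧_; not)
open import Data.Bool.Properties using (T-∧; T-∨; T-≡; not-involutive)
open import Data.List using (List; []; _∷_; _++_; map; length; lookup; tabulate; allFin; filterᵇ; cartesianProduct)
open import Data.List.Properties using (length-++; length-map; length-tabulate)
open import Data.List.Membership.Propositional using (_∈_; lose; find)
open import Data.List.Membership.Propositional.Properties
  using (∈-lookup; ∈-map⁻; ∈-++⁻; ∈-filter⁺; ∈-cartesianProduct⁺; ∈-allFin; ∈-tabulate⁻)
open import Data.List.Membership.Setoid.Properties using (index-injective)
open import Data.List.Relation.Unary.Any using (here; there)
open import Data.List.Relation.Unary.Any.Properties using (any⁺; any⁻)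
import Data.List.Relation.Unary.All as All
import Data.List.Relation.Unary.All.Properties as All
open import Data.List.Relation.Unary.Unique.Propositional using (Unique; []; _∷_)
import Data.List.Relation.Unary.Unique.Propositional.Properties as Unique
open import Data.List.Relation.Binary.Subset.Propositional using (_⊆_)
open import Data.Product using (_,_; proj₁; proj₂; ∃₂; swap)
open import Data.Sum using (_⊎_; inj₁; inj₂; [_,_])
open import Data.Empty using (⊥-elim)
open import Function using (_∘_; id)
open import Function.Bundles using (Equivalence; mk⇔)
open import Relation.Nullary using (¬_; Dec; yes; no; does)
open import Relation.Nullary.Decidable using (T?; dec-true; does-⇔; _×-dec_; _⊎-dec_)
open import Relation.Binary using (tri<; tri≈; tri>)
open import Relation.Binary.PropositionalEquality
  using (_≢_; refl; sym; trans; cong; cong₂; subst; setoid; module ≡-Reasoning)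

lookup-injective : ∀ {A : Set} {xs : List A} → Unique xs → Injective _≡_ _≡_ (lookup xs)
lookup-injective (x∉xs ∷ u) {Fin.zero}  {Fin.zero}  _  = refl
lookup-injective (x∉xs ∷ u) {Fin.zero}  {Fin.suc j} eq = ⊥-elim (All.lookup x∉xs (∈-lookup j) eq)
lookup-injective (x∉xs ∷ u) {Fin.suc i} {Fin.zero}  eq = ⊥-elim (All.lookup x∉xs (∈-lookup i) (sym eq))
lookup-injective (x∉xs ∷ u) {Fin.suc i} {Fin.suc j} eq = cong Fin.suc (lookup-injective u eq)

-- Positions in xs inject into positions in ys.
Unique-⊆⇒length≤ : ∀ {A : Set} {xs ys : List A} → Unique xs → xs ⊆ ys → length xs ≤ length ys
Unique-⊆⇒length≤ {A} u xs⊆ys = injective⇒≤ λ eq →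
  lookup-injective u (index-injective (setoid A) (xs⊆ys (∈-lookup _)) (xs⊆ys (∈-lookup _)) eq)

sortPair : ∀ {n} → Fin n → Fin n → Fin n × Fin n
sortPair a b with a <? b
... | yes _ = a , b
... | no  _ = b , a

sortPair-cases : ∀ {n} (a b : Fin n) → sortPair a b ≡ (a , b) ⊎ sortPair a b ≡ (b , a)
sortPair-cases a b with a <? b
... | yes _ = inj₁ refl
... | no  _ = inj₂ refl

sortPair-sorted : ∀ {n} {a b : Fin n} → a ≢ b → proj₁ (sortPair a b) < proj₂ (sortPair a b)
sortPair-sorted {a = a} {b} a≢b with a <? b
... | yes a<b = a<b
... | no  a≮b with <-cmp a b
...   | tri< a<b _ _ = ⊥-elim (a≮b a<b)
...   | tri≈ _ a≡b _ = ⊥-elim (a≢b a≡b)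
...   | tri> _ _ b<a = b<a

sortPair-injective : ∀ {n} {a b a′ b′ : Fin n} → sortPair a b ≡ sortPair a′ b′ →
                     (a ≡ a′ × b ≡ b′) ⊎ (a ≡ b′ × b ≡ a′)
sortPair-injective {a = a} {b} {a′} {b′} eq with sortPair-cases a b | sortPair-cases a′ b′
... | inj₁ p | inj₁ q with refl ← trans (sym p) (trans eq q) = inj₁ (refl , refl)
... | inj₁ p | inj₂ q with refl ← trans (sym p) (trans eq q) = inj₂ (refl , refl)
... | inj₂ p | inj₁ q with refl ← trans (sym p) (trans eq q) = inj₂ (refl , refl)
... | inj₂ p | inj₂ q with refl ← trans (sym p) (trans eq q) = inj₁ (refl , refl)

-- An unordered pair {a, b} is represented, as in transitiveClosureEdges, by its sorted pair.
pairsOf : ∀ {n} → List (Fin n) → List (Fin n × Fin n)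
pairsOf []       = []
pairsOf (x ∷ xs) = map (sortPair x) xs ++ pairsOf xs

length-pairsOf : ∀ {n} (xs : List (Fin n)) → length (pairsOf xs) ≡ length xs C 2
length-pairsOf []       = refl
length-pairsOf (x ∷ xs) = begin
  length (map (sortPair x) xs ++ pairsOf xs)   ≡⟨ length-++ (map (sortPair x) xs) ⟩
  length (map (sortPair x) xs) + length (pairsOf xs)
    ≡⟨ cong₂ _+_ (trans (length-map (sortPair x) xs) (sym (nC1≡n (length xs)))) (length-pairsOf xs) ⟩
  length xs C 1 + length xs C 2                ≡⟨ nCk+nC[k+1]≡[n+1]C[k+1] (length xs) 1 ⟩
  suc (length xs) C 2                          ∎
  where open ≡-Reasoning

∈-pairsOf⁻ : ∀ {n} {xs : List (Fin n)} {p} → Unique xs → p ∈ pairsOf xs →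
             ∃₂ λ a b → a ∈ xs × b ∈ xs × a ≢ b × p ≡ sortPair a b
∈-pairsOf⁻ {xs = x ∷ xs} (x∉xs ∷ u) p∈ with ∈-++⁻ (map (sortPair x) xs) p∈
... | inj₁ p∈map with y , y∈xs , refl ← ∈-map⁻ (sortPair x) p∈map =
  x , y , here refl , there y∈xs , (λ { refl → All.lookup x∉xs y∈xs refl }) , refl
... | inj₂ p∈pairs with a , b , a∈ , b∈ , a≢b , refl ← ∈-pairsOf⁻ u p∈pairs =
  a , b , there a∈ , there b∈ , a≢b , refl

Unique-pairsOf : ∀ {n} {xs : List (Fin n)} → Unique xs → Unique (pairsOf xs)
Unique-pairsOf []                          = []
Unique-pairsOf {xs = x ∷ xs} (x∉xs ∷ u′) =
  Unique.++⁺ (Unique.map⁺ sortPair-injectiveʳ u′) (Unique-pairsOf u′) disjoint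
  where
  sortPair-injectiveʳ : ∀ {y z} → sortPair x y ≡ sortPair x z → y ≡ z
  sortPair-injectiveʳ eq with sortPair-injective eq
  ... | inj₁ (_ , y≡z)   = y≡z
  ... | inj₂ (x≡z , y≡x) = trans y≡x x≡z

  x∉ : ∀ {a} → a ∈ xs → x ≢ a
  x∉ a∈ refl = All.lookup x∉xs a∈ refl

  disjoint : ∀ {p} → ¬ (p ∈ map (sortPair x) xs × p ∈ pairsOf xs)
  disjoint (p∈map , p∈pairs) with y , _ , refl ← ∈-map⁻ (sortPair x) p∈map
                             with a , b , a∈ , b∈ , _ , eq ← ∈-pairsOf⁻ u′ p∈pairs
    with sortPair-injective eq
  ... | inj₁ (x≡a , _) = x∉ a∈ x≡a
  ... | inj₂ (x≡b , _) = x∉ b∈ x≡b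

transitiveClosureEdges-clique : ∀ {n} (A : Adj n) (S : List (Fin n)) → Unique S →
  (∀ {a b} → a ∈ S → b ∈ S → a ≢ b → Connected A a b) →
  length S C 2 ≤ transitiveClosureEdges A
transitiveClosureEdges-clique {n} A S u clique =
  subst (_≤ transitiveClosureEdges A) (length-pairsOf S)
        (Unique-⊆⇒length≤ (Unique-pairsOf u) pairsOf⊆closure)
  where
  closurePair : Fin n × Fin n → Bool
  closurePair (a , b) = does (a <? b) ∧ connectedB A a b

  sorted-connected : ∀ {a b} → a ∈ S → b ∈ S → a ≢ b →
                     Connected A (proj₁ (sortPair a b)) (proj₂ (sortPair a b))
  sorted-connected {a} {b} a∈ b∈ a≢b with sortPair a b | sortPair-cases a b
  ... | _ | inj₁ refl = clique a∈ b∈ a≢b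
  ... | _ | inj₂ refl = clique b∈ a∈ (a≢b ∘ sym)

  closurePairs : List (Fin n × Fin n)
  closurePairs = filterᵇ closurePair (cartesianProduct (allFin n) (allFin n))

  ∈-closurePairs : ∀ {a b} → a < b → Connected A a b → (a , b) ∈ closurePairs
  ∈-closurePairs {a} {b} a<b a~b =
    ∈-filter⁺ (T? ∘ closurePair) (∈-cartesianProduct⁺ (∈-allFin a) (∈-allFin b))
      (Equivalence.from T-∧ (Equivalence.from T-≡ (dec-true (a <? b) a<b) , Equivalence.from T-≡ a~b))

  pairsOf⊆closure : pairsOf S ⊆ closurePairs
  pairsOf⊆closure p∈ with a , b , a∈ , b∈ , a≢b , refl ← ∈-pairsOf⁻ u p∈ =
    ∈-closurePairs (sortPair-sorted a≢b) (sorted-connected a∈ b∈ a≢b)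

2*[1+n]C2≡[1+n]*n : ∀ n → 2 * (suc n C 2) ≡ suc n * n
2*[1+n]C2≡[1+n]*n zero    = refl
2*[1+n]C2≡[1+n]*n (suc n) = begin
  2 * (suc (suc n) C 2)     ≡⟨ cong (2 *_) (sym (nCk+nC[k+1]≡[n+1]C[k+1] (suc n) 1)) ⟩
  2 * (suc n C 1 + suc n C 2) ≡⟨ cong (λ m → 2 * (m + suc n C 2)) (nC1≡n (suc n)) ⟩
  2 * (suc n + suc n C 2)   ≡⟨ *-distribˡ-+ 2 (suc n) (suc n C 2) ⟩
  2 * suc n + 2 * (suc n C 2) ≡⟨ cong (2 * suc n +_) (2*[1+n]C2≡[1+n]*n n) ⟩
  2 * suc n + suc n * n     ≡⟨ solve (n ∷ []) ⟩
  suc (suc n) * suc n       ∎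
  where open ≡-Reasoning

≤[1+n]C2 : ∀ {k} n → 2 * k ≤ n * n → k ≤ suc n C 2
≤[1+n]C2 {k} n 2k≤n² = *-cancelˡ-≤ 2 (begin
  2 * k               ≤⟨ 2k≤n² ⟩
  n * n               ≤⟨ *-monoˡ-≤ n (n≤1+n n) ⟩
  suc n * n           ≡⟨ sym (2*[1+n]C2≡[1+n]*n n) ⟩
  2 * (suc n C 2)     ∎)
  where open ≤-Reasoning

does⇒ : ∀ {P : Set} (P? : Dec P) → T (does P?) → P
does⇒ (yes p) _ = p

module _ {n} (A : Adj n) where

  reachWithin-refl : ∀ u → T (reachWithin A 0 u u)
  reachWithin-refl u = Equivalence.from T-≡ (dec-true (u ≟ u) refl)

  reachWithin-step : ∀ {j u w x} → T (reachWithin A j u w) → T (A w x) →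
                     T (reachWithin A (suc j) u x)
  reachWithin-step {j} {u} {w} {x} u~w w–x = Equivalence.from T-∨ (inj₂
    (any⁺ (λ y → reachWithin A j u y ∧ A y x)
          (lose (∈-allFin w) (Equivalence.from T-∧ (u~w , w–x)))))

  reachWithin-edge : ∀ {u w} → T (A u w) → T (reachWithin A 1 u w)
  reachWithin-edge {u} {w} = reachWithin-step {0} {u} {u} {w} (reachWithin-refl u)

  reachWithin-mono : ∀ {i j u w} → i ≤′ j → T (reachWithin A i u w) → T (reachWithin A j u w)
  reachWithin-mono ≤′-refl        = id
  reachWithin-mono (≤′-step i≤′j) = Equivalence.from T-∨ ∘ inj₁ ∘ reachWithin-mono i≤′j

  reachWithin⇒Connected : ∀ {j u w} → j ≤ n → T (reachWithin A j u w) → Connected A u w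
  reachWithin⇒Connected j≤n = Equivalence.to T-≡ ∘ reachWithin-mono (≤⇒≤′ j≤n)

  reachWithin-closed : (P : Fin n → Set) → (∀ {u w} → T (A u w) → P u × P w) →
                       ∀ j {u w} → T (reachWithin A j u w) → u ≡ w ⊎ P u × P w
  reachWithin-closed P closed zero    {u} {w} u~w = inj₁ (does⇒ (u ≟ w) u~w)
  reachWithin-closed P closed (suc j) {u} {w} u~w with Equivalence.to T-∨ u~w
  ... | inj₁ u~w′ = reachWithin-closed P closed j u~w′
  ... | inj₂ step with y , _ , u~y,y–w ← find (any⁻ _ (allFin n) step)
                  with u~y , y–w ← Equivalence.to T-∧ u~y,y–w
                  with Py , Pw ← closed y–w =
    inj₂ ([ (λ { refl → Py }) , proj₁ ] (reachWithin-closed P closed j u~y) , Pw)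

  AllComponentsColorful-closed : ∀ {m} (c : Fin n → Fin m) (P : Fin n → Set) →
    (∀ {u w} → T (A u w) → P u × P w) → (∀ {u w} → P u → P w → c u ≡ c w → u ≡ w) →
    AllComponentsColorful A c
  AllComponentsColorful-closed c P closed c-inj u w u≢w u~w cu≡cw
    with reachWithin-closed P closed n (Equivalence.from T-≡ u~w)
  ... | inj₁ u≡w       = u≢w u≡w
  ... | inj₂ (Pu , Pw) = u≢w (c-inj Pu Pw cu≡cw)

distinct⇒2≤ : ∀ {n} {a b : Fin n} → a ≢ b → 2 ≤ n
distinct⇒2≤ {suc zero}    {Fin.zero} {Fin.zero} a≢b = ⊥-elim (a≢b refl)
distinct⇒2≤ {suc (suc n)}                        _   = s≤s (s≤s z≤n)

module Star {n m} (E : Adj n) (c : Fin n → Fin m) (symE : SymmetricAdj E)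
            (centre : Fin n) {r} (leaf : Fin r → Fin n)
            (leaf–centre : ∀ i → E (leaf i) centre ≡ true)
            (leaf-colour-injective : Injective _≡_ _≡_ (c ∘ leaf))
            (leaf-colour≢centre : ∀ i → c (leaf i) ≢ c centre) where

  IsStarLeaf : Fin n → Set
  IsStarLeaf w = ∃ λ i → leaf i ≡ w

  InStar : Fin n → Set
  InStar w = w ≡ centre ⊎ IsStarLeaf w

  StarEdge : Fin n → Fin n → Set
  StarEdge u w = (u ≡ centre × IsStarLeaf w) ⊎ (IsStarLeaf u × w ≡ centre)

  StarEdge-sym : ∀ {u w} → StarEdge u w → StarEdge w u
  StarEdge-sym = [ inj₂ ∘ swap , inj₁ ∘ swap ]

  StarEdge⇒InStar : ∀ {u w} → StarEdge u w → InStar u × InStar w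
  StarEdge⇒InStar (inj₁ (u≡centre , w-leaf)) = inj₁ u≡centre , inj₂ w-leaf
  StarEdge⇒InStar (inj₂ (u-leaf , w≡centre)) = inj₂ u-leaf , inj₁ w≡centre

  starEdge? : ∀ u w → Dec (StarEdge u w)
  starEdge? u w = (u ≟ centre ×-dec any? (λ i → leaf i ≟ w))
             ⊎-dec (any? (λ i → leaf i ≟ u) ×-dec w ≟ centre)

  nonStarEdges : Adj n
  nonStarEdges u w = E u w ∧ not (does (starEdge? u w))

  starGraph : Adj n
  starGraph = remove E nonStarEdges

  starGraph-edge⁻ : ∀ {u w} → T (starGraph u w) → StarEdge u w
  starGraph-edge⁻ {u} {w} e with E u w
  ... | true  = does⇒ (starEdge? u w) (subst T (not-involutive _) e)
  ... | false = ⊥-elim e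

  starGraph-edge⁺ : ∀ {u w} → E u w ≡ true → StarEdge u w → T (starGraph u w)
  starGraph-edge⁺ {u} {w} e s rewrite e =
    subst T (sym (not-involutive _)) (Equivalence.from T-≡ (dec-true (starEdge? u w) s))

  colour-injective-on-star : ∀ {u w} → InStar u → InStar w → c u ≡ c w → u ≡ w
  colour-injective-on-star (inj₁ refl)       (inj₁ refl)       _   = refl
  colour-injective-on-star (inj₁ refl)       (inj₂ (j , refl)) eq = ⊥-elim (leaf-colour≢centre j (sym eq))
  colour-injective-on-star (inj₂ (i , refl)) (inj₁ refl)       eq = ⊥-elim (leaf-colour≢centre i eq)
  colour-injective-on-star (inj₂ (i , refl)) (inj₂ (j , refl)) eq = cong leaf (leaf-colour-injective eq)

  nonStarEdges-solution : IsMECSolution E c nonStarEdges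
  nonStarEdges-solution = nonStarEdges⊆E , nonStarEdges-sym , colourful
    where
    nonStarEdges⊆E : ∀ u w → nonStarEdges u w ≡ true → E u w ≡ true
    nonStarEdges⊆E u w e with E u w
    ... | true  = refl
    ... | false = e

    nonStarEdges-sym : SymmetricAdj nonStarEdges
    nonStarEdges-sym u w = cong₂ (λ e s → e ∧ not s) (symE u w)
      (does-⇔ (mk⇔ StarEdge-sym StarEdge-sym) (starEdge? u w) (starEdge? w u))

    colourful : AllComponentsColorful starGraph c
    colourful = AllComponentsColorful-closed starGraph c InStar
      (StarEdge⇒InStar ∘ starGraph-edge⁻) colour-injective-on-star

  starVertices : List (Fin n)
  starVertices = centre ∷ tabulate leaf

  Unique-starVertices : Unique starVertices
  Unique-starVertices =
    All.tabulate⁺ (λ i centre≡leaf → leaf-colour≢centre i (cong c (sym centre≡leaf)))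
    ∷ Unique.tabulate⁺ (leaf-colour-injective ∘ cong c)

  ∈-starVertices⇒InStar : ∀ {w} → w ∈ starVertices → InStar w
  ∈-starVertices⇒InStar (here w≡centre) = inj₁ w≡centre
  ∈-starVertices⇒InStar (there w∈)      with i , w≡leaf ← ∈-tabulate⁻ w∈ = inj₂ (i , sym w≡leaf)

  starGraph-leaf–centre : ∀ i → T (starGraph (leaf i) centre)
  starGraph-leaf–centre i = starGraph-edge⁺ (leaf–centre i) (inj₂ ((i , refl) , refl))

  starGraph-centre–leaf : ∀ i → T (starGraph centre (leaf i))
  starGraph-centre–leaf i =
    starGraph-edge⁺ (trans (symE centre (leaf i)) (leaf–centre i)) (inj₁ (refl , i , refl))

  edge⇒reach₂ : ∀ {u w} → T (starGraph u w) → T (reachWithin starGraph 2 u w)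
  edge⇒reach₂ {u} {w} = reachWithin-mono starGraph {1} {2} {u} {w} (≤′-step ≤′-refl)
                      ∘ reachWithin-edge starGraph {u} {w}

  starGraph-reach₂ : ∀ {u w} → InStar u → InStar w → u ≢ w → T (reachWithin starGraph 2 u w)
  starGraph-reach₂ (inj₁ refl)       (inj₁ refl)       u≢w = ⊥-elim (u≢w refl)
  starGraph-reach₂ (inj₁ refl)       (inj₂ (j , refl)) _   =
    edge⇒reach₂ (starGraph-centre–leaf j)
  starGraph-reach₂ (inj₂ (i , refl)) (inj₁ refl)       _   =
    edge⇒reach₂ (starGraph-leaf–centre i)
  starGraph-reach₂ (inj₂ (i , refl)) (inj₂ (j , refl)) _   =
    reachWithin-step starGraph {1} {leaf i} {centre} {leaf j}
      (reachWithin-edge starGraph (starGraph-leaf–centre i)) (starGraph-centre–leaf j)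

  starVertices-clique : ∀ {u w} → u ∈ starVertices → w ∈ starVertices → u ≢ w → Connected starGraph u w
  starVertices-clique u∈ w∈ u≢w = reachWithin⇒Connected starGraph (distinct⇒2≤ u≢w)
    (starGraph-reach₂ (∈-starVertices⇒InStar u∈) (∈-starVertices⇒InStar w∈) u≢w)

  star-solution : ∃ λ E′ → IsMECSolution E c E′ × suc r C 2 ≤ mecValue E E′
  star-solution = nonStarEdges , nonStarEdges-solution ,
    subst (λ s → suc s C 2 ≤ mecValue E nonStarEdges) (length-tabulate leaf)
      (transitiveClosureEdges-clique starGraph starVertices Unique-starVertices starVertices-clique)

lemma9 : ∀ {n m} (E : Adj n) (c : Fin n → Fin m) →
    SymmetricAdj E → Loopless E → NoMonochromaticEdge E c →
    (k : ℕ) → 1 ≤ k →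
    (root : Fin n) (parent : Fin n → Fin n) → IsDFSTree E root parent →
    (v : Fin n) → InVA root parent v →
    (r : ℕ) → 2 * k ≤ r * r →
    (f : Fin r → Fin m) → Injective _≡_ _≡_ f →
    (∀ i → ∃ λ ℓ → InCx root parent c v (f i) ℓ) →
    ∃ λ E′ → IsMECSolution E c E′ × k ≤ mecValue E E′
lemma9 {n} E c symE _ noMono k _ root parent ((_ , treeEdge , _) , _) v _ r 2k≤r² f f-inj hasLeaf
  = let E′ , isSolution , value = Star.star-solution E c symE v leaf leaf–v colour-injective colour≢v
    in E′ , isSolution , ≤-trans (≤[1+n]C2 r 2k≤r²) value
  where
  leaf : Fin r → Fin n
  leaf = proj₁ ∘ hasLeaf

  -- The tree edge joining v to a leaf ℓ cannot point from v to ℓ, as ℓ has no children.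
  leaf-child : ∀ i → leaf i ≢ root × parent (leaf i) ≡ v
  leaf-child i with hasLeaf i
  ... | _ , isLeaf , inj₁ (v≢root , parent-v) , _ = ⊥-elim (isLeaf v v≢root parent-v)
  ... | _ , _      , inj₂ child               , _ = child

  leaf–v : ∀ i → E (leaf i) v ≡ true
  leaf–v i with leaf≢root , parent≡v ← leaf-child i =
    subst (λ w → E (leaf i) w ≡ true) parent≡v (treeEdge (leaf i) leaf≢root)

  colour : ∀ i → c (leaf i) ≡ f i
  colour i = proj₂ (proj₂ (proj₂ (hasLeaf i)))

  colour-injective : Injective _≡_ _≡_ (c ∘ leaf)
  colour-injective {i} {j} eq = f-inj (trans (sym (colour i)) (trans eq (colour j)))

  colour≢v : ∀ i → c (leaf i) ≢ c v
  colour≢v i = noMono (leaf i) v (leaf–v i)
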